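{- Let $n\ge 1$ and let $S_n$ be the star with $n+1$ vertices (one center adjacent to $n$ leaves). If $S_n$ is a geometric mean graph, then $n\le 7$.
   Context: A finite simple graph $G$ with $p$ vertices and $q$ edges is a geometric mean graph if there is an injection $\psi: V(G)\to\{1,2,\dots,q+1\}$ such that, when each edge $uv$ is assigned one of the labels $\lfloor\sqrt{\psi(u)\psi(v)}\rfloor$ or $\lceil\sqrt{\psi(u)\psi(v)}\rceil$ (chosen per edge), the resulting set of edge labels is exactly $\{1,\dots,q\}$. -}

module Defs where

open import Data.Nat using (ℕ; zero; suc; _+_; _*_; _∸_; _≤_; _<_)
open import Data.Fin using (Fin; zero; suc)
open import Data.Product using (Σ; _×_; _,_; proj₁; proj₂; ∃-syntax)
open import Data.Sum using (_⊎_)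
open import Relation.Binary.PropositionalEquality using (_≡_; _≢_)
open import Function.Definitions using (Injective)
open import Relation.Nullary using (¬_)

record Graph : Set where
  field
    p : ℕ
    q : ℕ
    ends : Fin q → Fin p × Fin p
    loopless : ∀ e → proj₁ (ends e) ≢ proj₂ (ends e)
    noMulti : ∀ e f → e ≢ f →
      ¬ (proj₁ (ends e) ≡ proj₁ (ends f) × proj₂ (ends e) ≡ proj₂ (ends f))
      × ¬ (proj₁ (ends e) ≡ proj₂ (ends f) × proj₂ (ends e) ≡ proj₁ (ends f))

IsFloorSqrt : ℕ → ℕ → Set
IsFloorSqrt m r = r * r ≤ m × m < suc r * suc r

-- r = ⌈√m⌉  (for m ≥ 1; the case m = 0 gives r = 0)
IsCeilSqrt : ℕ → ℕ → Set
IsCeilSqrt m r = (m ≡ 0 × r ≡ 0) ⊎ (1 ≤ r × (r ∸ 1) * (r ∸ 1) < m × m ≤ r * r)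

IsGeoLabel : ℕ → ℕ → Set
IsGeoLabel m l = IsFloorSqrt m l ⊎ IsCeilSqrt m l

-- Geometric mean labeling: injective ψ : V → {1,…,q+1} and a per-edge choice
-- of label (floor or ceiling of √(ψ u ψ v)) such that the edge labels are
-- exactly {1,…,q}, i.e. the label map is a bijection from edges onto {1,…,q}.
record GeometricMeanLabeling (G : Graph) : Set where
  open Graph G
  field
    ψ : Fin p → ℕ
    ψ-inj : Injective _≡_ _≡_ ψ
    ψ-range : ∀ v → 1 ≤ ψ v × ψ v ≤ suc q
    label : Fin q → ℕ
    label-ok : ∀ e → IsGeoLabel (ψ (proj₁ (ends e)) * ψ (proj₂ (ends e))) (label e)
    label-range : ∀ e → 1 ≤ label e × label e ≤ q
    label-onto : ∀ k → 1 ≤ k → k ≤ q → ∃[ e ] label e ≡ k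

IsGeometricMean : Graph → Set
IsGeometricMean G = GeometricMeanLabeling G

starEnds : (n : ℕ) → Fin n → Fin (suc n) × Fin (suc n)
starEnds n i = zero , suc i

star : ℕ → Graph
star n = record
  { p = suc n ; q = n ; ends = starEnds n
  ; loopless = λ e ()
  ; noMulti = λ e f e≢f → (λ { (_ , refl) → e≢f refl }) , (λ { (() , _) }) }
  where open import Relation.Binary.PropositionalEquality using (refl)

-- Let ψ be a geometric mean labeling of the star S_n (n ≥ 1) with centre
-- value c.  Two general facts about a label l ∈ {⌊√m⌋, ⌈√m⌉} drive the proof:
-- it satisfies m < (l+1)², and if l = k+1 then k² < m.
--  * Some edge carries label 1, so c·a < 4 for a leaf value a ≥ 1; hence c ≤ 3.
--  * Some edge carries label n = m+1, so m² < c·b for a leaf value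
--    b ≤ n+1 = m+2; hence m² < 3(m+2).
module Submission where

open import Defs
open import Data.Nat using (ℕ; suc; _+_; _*_; _≤_; _<_; z≤n; s≤s; _≤?_)
open import Data.Nat.Properties
open import Data.Fin using (Fin)
open import Data.Product using (_,_; proj₁; proj₂; ∃-syntax)
open import Data.Sum using (inj₁; inj₂)
open import Relation.Binary.PropositionalEquality using (_≡_; refl; subst)
open import Relation.Nullary using (yes; no; contradiction)
open import Data.Nat.Solver using (module +-*-Solver)
open +-*-Solver using (solve; _:+_; _:*_; _:=_; con)

geoLabel-upper : ∀ {m l} → IsGeoLabel m l → m < suc l * suc l
geoLabel-upper (inj₁ (_ , m<[l+1]²)) = m<[l+1]²
geoLabel-upper (inj₂ (inj₁ (m≡0 , _))) rewrite m≡0 = s≤s z≤n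
geoLabel-upper {l = l} (inj₂ (inj₂ (_ , _ , m≤l²))) =
  ≤-<-trans m≤l² (*-mono-< (n<1+n l) (n<1+n l))

geoLabel-lower : ∀ {m k} → IsGeoLabel m (suc k) → k * k < m
geoLabel-lower {k = k} (inj₁ ([k+1]²≤m , _)) =
  <-≤-trans (*-mono-< (n<1+n k) (n<1+n k)) [k+1]²≤m
geoLabel-lower (inj₂ (inj₁ (_ , ())))
geoLabel-lower (inj₂ (inj₂ (_ , k²<m , _))) = k²<m

-- For m ≥ 7 the square m² already exceeds 3(m+2), since m² ≥ 7m.
triple≤square : ∀ k → 3 * (2 + (7 + k)) ≤ (7 + k) * (7 + k)
triple≤square k = begin
  3 * (2 + (7 + k))       ≤⟨ m≤m+n (3 * (2 + (7 + k))) (22 + 4 * k) ⟩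
  3 * (2 + (7 + k)) + (22 + 4 * k)
                          ≡⟨ seven-times k ⟩
  7 * (7 + k)             ≤⟨ *-monoˡ-≤ (7 + k) (m≤m+n 7 k) ⟩
  (7 + k) * (7 + k)       ∎
  where
  open ≤-Reasoning
  seven-times : ∀ k → 3 * (2 + (7 + k)) + (22 + 4 * k) ≡ 7 * (7 + k)
  seven-times = solve 1 (λ k →
    con 3 :* (con 2 :+ (con 7 :+ k)) :+ (con 22 :+ con 4 :* k) := con 7 :* (con 7 :+ k)) refl

square<triple⇒≤6 : ∀ m → m * m < 3 * (2 + m) → m ≤ 6
square<triple⇒≤6 m m²<3[m+2] with m ≤? 6
... | yes m≤6 = m≤6
... | no m≰6 with m≤n⇒∃[o]m+o≡n (≰⇒> m≰6)
...   | k , refl = contradiction m²<3[m+2] (≤⇒≯ (triple≤square k))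

module StarLabeling {m : ℕ} (L : GeometricMeanLabeling (star (suc m))) where
  open GeometricMeanLabeling L

  centre : ℕ
  centre = ψ Fin.zero

  leaf : Fin (suc m) → ℕ
  leaf i = ψ (Fin.suc i)

  -- Some edge is labelled 1, so centre · leaf < 4 with leaf ≥ 1.
  centre≤3 : centre ≤ 3
  centre≤3 with label-onto 1 ≤-refl (s≤s z≤n)
  ... | i , label≡1 = begin
    centre              ≡⟨ *-identityʳ centre ⟨
    centre * 1          ≤⟨ *-monoʳ-≤ centre (proj₁ (ψ-range (Fin.suc i))) ⟩
    centre * leaf i     ≤⟨ ≤-pred (geoLabel-upper (subst (IsGeoLabel _) label≡1 (label-ok i))) ⟩
    3                   ∎
    where open ≤-Reasoning

  -- Some edge is labelled m+1, so its end-value product exceeds m².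
  top-label : ∃[ i ] m * m < centre * leaf i
  top-label with label-onto (suc m) (s≤s z≤n) ≤-refl
  ... | i , label≡m+1 = i , geoLabel-lower (subst (IsGeoLabel _) label≡m+1 (label-ok i))

  product≤ : ∀ i → centre * leaf i ≤ 3 * (2 + m)
  product≤ i = *-mono-≤ centre≤3 (proj₂ (ψ-range (Fin.suc i)))

mainTheorem3 : ∀ n → 1 ≤ n → IsGeometricMean (star n) → n ≤ 7
mainTheorem3 (suc m) (s≤s z≤n) L = s≤s (square<triple⇒≤6 m (begin-strict
  m * m               <⟨ proj₂ top-label ⟩
  centre * leaf i     ≤⟨ product≤ i ⟩
  3 * (2 + m)         ∎))
  where
  open StarLabeling L
  open ≤-Reasoning
  i : Fin (suc m)
  i = proj₁ top-label
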